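{- Let $G=(V,E)$ be a directed graph, $s\neq t$ vertices, $k$ a positive integer and $v\in V$. Then $(s,v)\in E$ and $EV^\ast_{k-1}(v,t)$ exists if and only if $(s,v)$ is an edge of $SPG_k(s,t)$.
   Context: A path from $x$ to $y$ is a vertex sequence $x=v_0,\ldots,v_l=y$ with $(v_{i-1},v_i)\in E$; its length is $l$ (length $0$ allowed); $V(p)$ is its vertex set; it is simple if its vertices are pairwise distinct. $P_l^\ast(x,y)$ is the set of simple paths from $x$ to $y$ of length at most $l$. $SPG_k(s,t)$ is the subgraph of $G$ formed by the union of vertices and edges of all simple $s$-$t$ paths of length at most $k$. $EV_l^\ast(v,t)=\bigcap\{V(p): p\in P_l^\ast(v,t),\ s\notin V(p)\}$, and it exists iff some $p\in P_l^\ast(v,t)$ has $s\notin V(p)$. -}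

module Defs where

open import Level using (Level; _⊔_)
open import Data.Nat using (ℕ; suc; _≤_)
open import Data.List using (List; []; _∷_)
open import Data.List.Membership.Propositional using (_∈_; _∉_)
open import Data.List.Relation.Unary.Unique.Propositional using (Unique)
open import Data.Product using (Σ; _×_; ∃)

module _ {a b : Level} {V : Set a} (E : V → V → Set b) where

  data Path : V → V → Set (a ⊔ b) where
    []  : ∀ {x} → Path x x
    _∷_ : ∀ {x y z} → E x y → Path y z → Path x z

  verts : ∀ {x y} → Path x y → List V
  verts {x} []      = x ∷ []
  verts {x} (_ ∷ p) = x ∷ verts p

  len : ∀ {x y} → Path x y → ℕ
  len []      = 0
  len (_ ∷ p) = suc (len p)

  Simple : ∀ {x y} → Path x y → Set a
  Simple p = Unique (verts p)

  InPStar : ℕ → ∀ {x y} → Path x y → Set a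
  InPStar l p = Simple p × len p ≤ l

  data EdgeOn (u w : V) : ∀ {x y} → Path x y → Set (a ⊔ b) where
    here  : ∀ {z} (e : E u w) (p : Path w z) → EdgeOn u w (e ∷ p)
    there : ∀ {x y z} (e : E x y) {p : Path y z} → EdgeOn u w p → EdgeOn u w (e ∷ p)

  EdgeOfSPG : ℕ → V → V → V → V → Set (a ⊔ b)
  EdgeOfSPG k s t u w = Σ (Path s t) λ p → InPStar k p × EdgeOn u w p

  -- EV*_l(v,t) (w.r.t. s) as a predicate on vertices: u lies on every
  -- p ∈ P*_l(v,t) with s ∉ V(p)
  EV* : ℕ → V → V → V → V → Set (a ⊔ b)
  EV* l s v t u = ∀ (p : Path v t) → InPStar l p → s ∉ verts p → u ∈ verts p

  -- EV*_l(v,t) exists iff some p ∈ P*_l(v,t) has s ∉ V(p)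
  EV*-exists : ℕ → V → V → V → Set (a ⊔ b)
  EV*-exists l s v t = Σ (Path v t) λ p → InPStar l p × s ∉ verts p

module Submission where

open import Defs
open import Level using (Level)
open import Data.Nat using (ℕ; _≤_; _∸_; suc; s≤s)
open import Data.Product using (_×_; _,_)
open import Relation.Binary.PropositionalEquality using (_≢_; refl)
open import Relation.Nullary using (¬_)
open import Function.Bundles using (_⇔_; mk⇔)
open import Data.List.Membership.Propositional using (_∈_; _∉_)
open import Data.List.Relation.Unary.Any using (here; there)
open import Data.List.Relation.Unary.All.Properties using (¬Any⇒All¬)
open import Data.List.Relation.Unary.AllPairs using (_∷_)
open import Data.List.Relation.Unary.Unique.Propositional.Properties using (Unique[x∷xs]⇒x∉xs)
open import Data.Empty using (⊥-elim)

module _ {a b : Level} {V : Set a} {E : V → V → Set b} where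

  EdgeOn⇒source∈verts : ∀ {u w x y} {p : Path E x y} → EdgeOn E u w p → u ∈ verts E p
  EdgeOn⇒source∈verts (here e p)  = here refl
  EdgeOn⇒source∈verts (there e q) = there (EdgeOn⇒source∈verts q)

  Simple-∷⁺ : ∀ {x y z} (e : E x y) {p : Path E y z} →
              x ∉ verts E p → Simple E p → Simple E (e ∷ p)
  Simple-∷⁺ e {p} x∉p p-simple = ¬Any⇒All¬ (verts E p) x∉p ∷ p-simple

  Simple-∷⇒¬EdgeOn-tail : ∀ {x y z w} {e : E x y} {p : Path E y z} →
                          Simple E (e ∷ p) → ¬ EdgeOn E x w p
  Simple-∷⇒¬EdgeOn-tail q-simple xw∈p =
    Unique[x∷xs]⇒x∉xs q-simple (EdgeOn⇒source∈verts xw∈p)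

lemma2 : {a b : Level} {V : Set a} (E : V → V → Set b) (s t : V) → s ≢ t →
    (k : ℕ) → 1 ≤ k → (v : V) →
    ((E s v × EV*-exists E (k ∸ 1) s v t) ⇔ EdgeOfSPG E k s t s v)
lemma2 E s t _ (suc k) (s≤s _) v = mk⇔ prepend-edge first-edge
  where
  prepend-edge : E s v × EV*-exists E k s v t → EdgeOfSPG E (suc k) s t s v
  prepend-edge (e , p , (p-simple , len≤k) , s∉p) =
    e ∷ p , (Simple-∷⁺ e s∉p p-simple , s≤s len≤k) , here e p

  first-edge : EdgeOfSPG E (suc k) s t s v → E s v × EV*-exists E k s v t
  first-edge (_ , (q-simple@(_ ∷ p-simple) , s≤s len≤k) , here e p) =
    e , p , (p-simple , len≤k) , Unique[x∷xs]⇒x∉xs q-simple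
  first-edge (_ , (q-simple , _) , there e sv∈p) =
    ⊥-elim (Simple-∷⇒¬EdgeOn-tail {e = e} q-simple sv∈p)
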